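{- For all integers $n,\ell\ge2$, $\mathsf{PHP}^{n^\ell+1}_n<\mathsf{PHP}^{n^\ell}_n$; that is, $\mathsf{PHP}^{n^\ell+1}_n\le\mathsf{PHP}^{n^\ell}_n$ and $\mathsf{PHP}^{n^\ell}_n\not\le\mathsf{PHP}^{n^\ell+1}_n$.
   Context: A number $N\ge1$ is identified with $\{0,\dots,N-1\}$. A (finite) problem $\mathsf{P}$ consists of a nonempty finite set of instances and, for each instance $x$, a nonempty finite set $\mathsf{P}(x)$ of solutions. For finite problems, $\mathsf{P}\le\mathsf{Q}$ if there exist a map $\Phi$ sending each $\mathsf{P}$-instance $x$ to a $\mathsf{Q}$-instance and a (partial) map $\Psi$ on $\mathsf{Q}$-solutions such that $\Psi(y)\in\mathsf{P}(x)$ whenever $y\in\mathsf{Q}(\Phi(x))$ ($\Psi$ does not have access to $x$). For $m>n\ge2$, $\mathsf{PHP}^m_n$ has as instances all functions $f:m\to n$, with solutions all unordered pairs $\{i,j\}$, $i\ne j$, $f(i)=f(j)$. -}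

module Defs where

open import Data.Nat using (ℕ)
open import Data.Fin using (Fin; _<_)
open import Data.Product using (Σ; _×_; ∃; _,_)
open import Data.Maybe using (Maybe; just)
open import Relation.Binary.PropositionalEquality using (_≡_)
open import Relation.Nullary using (¬_)
open import Level using (0ℓ) renaming (suc to lsuc)

record Problem : Set₁ where
  field
    Inst   : Set
    Sol    : Set
    IsSol  : Inst → Sol → Set

open Problem public

_≤ᵖ_ : Problem → Problem → Set
P ≤ᵖ Q = Σ (Inst P → Inst Q) λ Φ → Σ (Sol Q → Maybe (Sol P)) λ Ψ →
  ∀ x y → IsSol Q (Φ x) y → ∃ λ z → (Ψ y ≡ just z) × IsSol P x z

-- Unordered pairs {i,j}, i ≠ j, of elements of m, represented canonically
-- as (i , j) with i < j.
UPair : ℕ → Set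
UPair m = Σ (Fin m) λ i → Σ (Fin m) λ j → i < j

PHP : ℕ → ℕ → Problem
PHP m n = record
  { Inst  = Fin m → Fin n
  ; Sol   = UPair m
  ; IsSol = λ { f (i , j , _) → f i ≡ f j }
  }

_<ᵖ_ : Problem → Problem → Set
P <ᵖ Q = (P ≤ᵖ Q) × ¬ (Q ≤ᵖ P)

{-# OPTIONS --safe #-}
-- Reducing PHP^{m+1}_n to PHP^m_n is easy: restrict the instance to the first
-- m pigeons. For the converse with m = n^ℓ, feed a putative reduction the ℓ
-- base-n digit functions m → n. Their images are ℓ maps m+1 → n; tupled they
-- give a map m+1 → n^ℓ = m, so by pigeonhole they share one collision {a,b}.
-- Since Ψ does not see the instance, Ψ{a,b} must then be a collision of every
-- digit function at once, which is impossible because digits determine the number.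
module Submission where

open import Defs
open import Data.Nat using (ℕ; zero; suc; _≥_; _^_; _+_; _≤_; _<_; _>_; z<s)
open import Data.Nat.Properties using (m≤m+n; m<m+n; <-≤-trans; <-irrefl)
open import Data.Fin using (Fin; zero; suc; toℕ; inject≤; combine; finToFun; funToFin; fromℕ<)
open import Data.Fin.Properties
  using (toℕ-inject≤; pigeonhole; finToFun-funToFin; funToFin-finToFin)
open import Data.Product using (∃; _,_; proj₁)
open import Data.Maybe using (just)
open import Data.Maybe.Properties using (just-injective)
open import Function using (_∘_)
open import Relation.Binary.PropositionalEquality
  using (_≡_; refl; sym; trans; cong; cong₂; subst; subst₂; _≗_; module ≡-Reasoning)
open import Relation.Nullary using (¬_)

CommonSolution : (P : Problem) {T : Set} → (T → Inst P) → Sol P → Set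
CommonSolution P xs z = ∀ t → IsSol P (xs t) z

≤ᵖ-reflects-common-solution :
  ∀ {P Q : Problem} {T : Set} (r : P ≤ᵖ Q) (xs : T → Inst P) → T →
  (∃ λ y → CommonSolution Q (proj₁ r ∘ xs) y) → ∃ λ z → CommonSolution P xs z
≤ᵖ-reflects-common-solution {P} (_ , _ , sound) xs t₀ (y , common)
  with sound (xs t₀) y (common t₀)
... | z , Ψy≡z , _ = z , solves
  where
  solves : CommonSolution P xs z
  solves t with sound (xs t) y (common t)
  ... | z′ , Ψy≡z′ , z′-solves =
    subst (IsSol P (xs t)) (just-injective (trans (sym Ψy≡z′) Ψy≡z)) z′-solves

funToFin-cong : ∀ {m n} {f g : Fin m → Fin n} → f ≗ g → funToFin f ≡ funToFin g
funToFin-cong {zero}  f≗g = refl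
funToFin-cong {suc m} f≗g = cong₂ combine (f≗g zero) (funToFin-cong (f≗g ∘ suc))

finToFun-injective : ∀ {m n} {i j : Fin (n ^ m)} →
                     finToFun {n} {m} i ≗ finToFun j → i ≡ j
finToFun-injective {m} {n} {i} {j} same = begin
  i                               ≡⟨ sym (funToFin-finToFin {m} {n} i) ⟩
  funToFin (finToFun {n} {m} i)   ≡⟨ funToFin-cong same ⟩
  funToFin (finToFun {n} {m} j)   ≡⟨ funToFin-finToFin {m} {n} j ⟩
  j                               ∎
  where open ≡-Reasoning

digit : ∀ {n} ℓ → Fin ℓ → Fin (n ^ ℓ) → Fin n
digit ℓ t x = finToFun x t

digits-have-no-common-collision :
  ∀ n ℓ → ¬ ∃ λ c → CommonSolution (PHP (n ^ ℓ) n) (digit ℓ) c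
digits-have-no-common-collision n ℓ ((i , j , i<j) , collides) =
  <-irrefl (cong toℕ (finToFun-injective {ℓ} {n} collides)) i<j

PHP-families-have-common-collision :
  ∀ {k n} ℓ → n ^ ℓ < k → (gs : Fin ℓ → Fin k → Fin n) →
  ∃ λ c → CommonSolution (PHP k n) gs c
PHP-families-have-common-collision ℓ n^ℓ<k gs
  with i , j , i<j , same-code ← pigeonhole n^ℓ<k (λ a → funToFin (λ t → gs t a))
  = (i , j , i<j) , collides
  where
  collides : ∀ t → gs t i ≡ gs t j
  collides t = begin
    gs t i                                    ≡⟨ sym (finToFun-funToFin (λ t → gs t i) t) ⟩
    finToFun (funToFin (λ t → gs t i)) t      ≡⟨ cong (λ x → finToFun x t) same-code ⟩
    finToFun (funToFin (λ t → gs t j)) t      ≡⟨ finToFun-funToFin (λ t → gs t j) t ⟩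
    gs t j                                    ∎
    where open ≡-Reasoning

PHP-≤ᵖ-fewer-pigeons : ∀ {k m n} → k ≤ m → PHP m n ≤ᵖ PHP k n
PHP-≤ᵖ-fewer-pigeons {k} {m} k≤m =
  (λ f → f ∘ inject) , just ∘ injectPair , λ _ _ collides → _ , refl , collides
  where
  inject : Fin k → Fin m
  inject i = inject≤ i k≤m
  injectPair : UPair k → UPair m
  injectPair (i , j , i<j) =
    inject i , inject j , subst₂ _<_ (sym (toℕ-inject≤ i k≤m)) (sym (toℕ-inject≤ j k≤m)) i<j

PHP-^-≰ᵖ-one-more-pigeon : ∀ n ℓ → ℓ > 0 → ¬ (PHP (n ^ ℓ) n ≤ᵖ PHP (n ^ ℓ + 1) n)
PHP-^-≰ᵖ-one-more-pigeon n ℓ ℓ>0 r@(Φ , _) =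
  digits-have-no-common-collision n ℓ
    (≤ᵖ-reflects-common-solution {Q = PHP (n ^ ℓ + 1) n} r (digit ℓ) (fromℕ< ℓ>0)
      (PHP-families-have-common-collision ℓ (m<m+n (n ^ ℓ) z<s) (Φ ∘ digit ℓ)))

proposition1p5 : ∀ (n ℓ : ℕ) → n ≥ 2 → ℓ ≥ 2 →
    PHP (n ^ ℓ + 1) n <ᵖ PHP (n ^ ℓ) n
proposition1p5 n ℓ _ ℓ≥2 =
  PHP-≤ᵖ-fewer-pigeons (m≤m+n (n ^ ℓ) 1) , PHP-^-≰ᵖ-one-more-pigeon n ℓ (<-≤-trans z<s ℓ≥2)
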